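{- Let $S\subseteq\mathbb{Z}$ be a finite set satisfying $S=-S$ and ($\forall s,t\in\mathbb{N}\setminus S$, $s+t\notin S$), let $m=\max(S)$, let $n\ge1$, and let $(T,\mu)\in\overline{\mathcal{T}}_m^n$ be $\mathcal{A}_S^n$-connected. (1) If $0\in S$, then $(T,\mu)\in\overline{\mathcal{T}}_m^n(\mathcal{A}_S^n)$ if and only if for every cadet edge $\{i,j\}\notin\mu$, with $i$ the $s$-cadet of $j$, one has $s\in C_S^{\mathrm{end}(B),\mathrm{start}(B')}$, where $B$ and $B'$ are the blocks containing $j$ and $i$ respectively. (2) If $0\notin S$, then $(T,\mu)\in\overline{\mathcal{T}}_m^n(\mathcal{A}_S^n)$ if and only if for every cadet edge $\{i,j\}\notin\mu$, with $i$ the $s$-cadet of $j$, one has $s\in C_S^{\mathrm{end}(B),\mathrm{start}(B')}$ and ($s>0$ or $|B|>1$ or $|B'|>1$ or $i<j$), where $B$ and $B'$ are the blocks containing $j$ and $i$ respectively.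
   Context: $\mathbb{N}=\{0,1,\dots\}$, $[a;b]=\{k\in\mathbb{Z}:a\le k\le b\}$, $[n]=[1;n]$. $\{x_i-x_j=s\}=\{x\in\mathbb{R}^n:x_i-x_j=s\}$; $\mathcal{A}_S^n=\{\{x_i-x_j=s\}:1\le i<j\le n,\ s\in S\}$. An $(m,n)$-tree is a rooted plane tree in which each node has exactly $m+1$ ordered children ($0$-child, ..., $m$-child), each a node or a leaf, with $n$ nodes labeled bijectively by $[n]$. Node $i$ is the $s$-cadet of $j$ if $i$ is the $s$-child of $j$ and the $t$-child of $j$ is a leaf for all $t\in[s+1;m]$; $\{i,j\}$ is a cadet edge. For a vertex $v$ with root-to-$v$ path $v_0,\dots,v_k=v$, $\mathrm{drift}_T(v)=\sum_i s_i$ where $v_i$ is the $s_i$-child of $v_{i-1}$. A marked $(m,n)$-tree is $(T,\mu)$ with $\mu$ a set of cadet edges such that if $\{j,i\}\in\mu$ with $i$ the $0$-cadet of $j$ then $j<i$; $\overline{\mathcal{T}}_m^n$ is the set of these. $i\overset{\mu}{\sim}j$ iff $i=j$ or every edge on the tree path between $i,j$ is in $\mu$; classes are the blocks. For an arrangement $\mathcal{A}$: $(T,\mu)$ is $\mathcal{A}$-connected if for each block $B$ the graph on $B$ with edges $\{i,j\}$ such that $\{x_i-x_j=\mathrm{drift}_T(i)-\mathrm{drift}_T(j)\}\in\mathcal{A}$ is connected; it satisfies the $\mathcal{A}$-cadet condition if each cadet edge $\{i,j\}\notin\mu$ with $i$ the $s$-cadet of $j$ satisfies ($s=0$ and $i<j$)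 or there exist $i'\overset{\mu}{\sim}i$, $j'\overset{\mu}{\sim}j$ with $\{x_{i'}-x_{j'}=\mathrm{drift}_T(i')-\mathrm{drift}_T(j')\}\in\mathcal{A}$; $\overline{\mathcal{T}}_m^n(\mathcal{A})$ is the set of $\mathcal{A}$-connected marked trees satisfying the $\mathcal{A}$-cadet condition. The shadow of a block $B$ is $\mathrm{shadow}(B)=\{\mathrm{drift}_T(j)-\mathrm{drift}_T(a):j\in B\}$, with $a\in B$ the ancestor of all nodes of $B$. For a finite $D\subseteq\mathbb{N}$: $\mathrm{start}(D)=D\cap[1;m-1]$ and $\mathrm{end}(D)=\{\max(D)-d:d\in D\}\cap[1;m-1]$; write $\mathrm{start}(B)=\mathrm{start}(\mathrm{shadow}(B))$, $\mathrm{end}(B)=\mathrm{end}(\mathrm{shadow}(B))$. For $V,W\subseteq[1;m-1]$, $C_S^{V,W}=\{0\}\cup\{s\in[1;m]:\exists d\in\{0\}\cup V,\ \exists d'\in\{0\}\cup W,\ s+d+d'\in S\}$. -}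

module Defs where

open import Data.Nat as ℕ using (ℕ; zero; suc; _+_; _∸_; _≤_; _<_)
open import Data.Integer as ℤ using (ℤ; +_; -_; _-_)
open import Data.Fin as Fin using (Fin; toℕ)
open import Data.Vec as Vec using (Vec; []; _∷_; lookup)
open import Data.List as List using (List; []; _∷_; _++_; _∷ʳ_; upTo; length)
open import Data.Nat.ListAction using (sum)
open import Data.List.Membership.Propositional using (_∈_)
open import Data.List.Relation.Binary.Permutation.Propositional using (_↭_)
open import Data.Maybe as Maybe using (Maybe; just; nothing)
open import Data.Bool using (if_then_else_)
open import Data.Product using (Σ; ∃; ∃-syntax; _×_; _,_)
open import Data.Sum using (_⊎_)
open import Relation.Nullary using (¬_; yes; no)
open import Relation.Binary.PropositionalEquality using (_≡_; _≢_)
open import Relation.Binary.Construct.Closure.ReflexiveTransitive using (Star)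

-- Plane trees in which every node has exactly m+1 ordered children
-- (0-child, …, m-child), each child being a node (carrying a label) or a leaf.

data Tree (m : ℕ) : Set where
  leaf : Tree m
  node : ℕ → Vec (Tree m) (suc m) → Tree m

-- Address of a vertex: the sequence of child indices from the root.
Addr : ℕ → Set
Addr m = List (Fin (suc m))

module _ {m : ℕ} where

  labels : Tree m → List ℕ
  labelsV : ∀ {k} → Vec (Tree m) k → List ℕ
  labels leaf = []
  labels (node i cs) = i ∷ labelsV cs
  labelsV [] = []
  labelsV (t ∷ ts) = labels t ++ labelsV ts

  subtree : Tree m → Addr m → Tree m
  subtree t [] = t
  subtree leaf (_ ∷ _) = leaf
  subtree (node _ cs) (k ∷ α) = subtree (lookup cs k) α

  find : ℕ → Tree m → Maybe (Addr m)
  findV : ℕ → ∀ {k} → Vec (Tree m) k → Maybe (Fin k × Addr m)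
  find i leaf = nothing
  find i (node j cs) =
    if j ℕ.≡ᵇ i then just [] else Maybe.map (λ { (k , α) → k ∷ α }) (findV i cs)
  findV i [] = nothing
  findV i (t ∷ ts) with find i t
  ... | just α = just (Fin.zero , α)
  ... | nothing = Maybe.map (λ { (k , α) → Fin.suc k , α }) (findV i ts)

  -- address of node i in T (only meaningful for labels i of T)
  addr : Tree m → ℕ → Addr m
  addr T i = Maybe.fromMaybe [] (find i T)

  drift : Tree m → ℕ → ℕ
  drift T i = sum (List.map toℕ (addr T i))

  Node : Tree m → ℕ → Set
  Node T i = i ∈ labels T

  IsChild : Tree m → ℕ → ℕ → Fin (suc m) → Set
  IsChild T i j s = Node T j × ∃[ cs ] (subtree T (addr T j ∷ʳ s) ≡ node i cs)

  IsCadet : Tree m → ℕ → ℕ → Fin (suc m) → Set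
  IsCadet T i j s =
    IsChild T i j s × (∀ (t : Fin (suc m)) → s Fin.< t → subtree T (addr T j ∷ʳ t) ≡ leaf)

  CadetEdge : Tree m → ℕ → ℕ → Set
  CadetEdge T i j = (∃[ s ] IsCadet T i j s) ⊎ (∃[ s ] IsCadet T j i s)

  lcp : Addr m → Addr m → Addr m
  lcp (a ∷ α) (b ∷ β) with a Fin.≟ b
  ... | yes _ = a ∷ lcp α β
  ... | no _ = []
  lcp _ _ = []

  IsPrefix : Addr m → Addr m → Set
  IsPrefix α β = ∃[ γ ] (α ++ γ ≡ β)

  -- The edge {v, parent(v)} lies on the tree path between i and j:
  -- v lies strictly below the lowest common ancestor of i and j and is
  -- an ancestor (or equal) of i or of j.
  OnPath : Tree m → ℕ → ℕ → ℕ → Set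
  OnPath T i j v =
    (IsPrefix (addr T v) (addr T i) ⊎ IsPrefix (addr T v) (addr T j))
    × length (lcp (addr T i) (addr T j)) < length (addr T v)

-- Markings: μ is a finite set of (unordered) edges, given as a list of pairs.

Marking : Set
Marking = List (ℕ × ℕ)

InMu : Marking → ℕ → ℕ → Set
InMu μ i j = (i , j) ∈ μ ⊎ (j , i) ∈ μ

IsMNTree : (m n : ℕ) → Tree m → Set
IsMNTree m n T = labels T ↭ List.map suc (upTo n)

IsMarked : (m n : ℕ) → Tree m → Marking → Set
IsMarked m n T μ =
  IsMNTree m n T
  × (∀ a b → (a , b) ∈ μ → CadetEdge T a b)
  × (∀ i j → InMu μ j i → IsCadet T i j Fin.zero → j < i)

module _ {m : ℕ} where

  SameBlock : Tree m → Marking → ℕ → ℕ → Set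
  SameBlock T μ i j =
    i ≡ j ⊎ (∀ v u (s : Fin (suc m)) → IsChild T v u s → OnPath T i j v → InMu μ v u)

  InBlock : Tree m → Marking → ℕ → ℕ → Set
  InBlock T μ r j = Node T j × SameBlock T μ r j

-- The hyperplane {x_i - x_j = x} belongs to
-- A_S^n = {{x_a - x_b = t} : 1 ≤ a < b ≤ n, t ∈ S} iff it coincides with
-- one of these, i.e. (a,b,t) = (i,j,x) or (a,b,t) = (j,i,-x).

HypIn : List ℤ → ℕ → ℕ → ℕ → ℤ → Set
HypIn S n i j x =
  (1 ≤ i × i < j × j ≤ n × x ∈ S) ⊎ (1 ≤ j × j < i × i ≤ n × - x ∈ S)

module _ {m : ℕ} where

  DriftHyp : List ℤ → ℕ → Tree m → ℕ → ℕ → Set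
  DriftHyp S n T i j = HypIn S n i j (+ drift T i - + drift T j)

  AConnected : List ℤ → ℕ → Tree m → Marking → Set
  AConnected S n T μ =
    ∀ r → Node T r → ∀ i j → InBlock T μ r i → InBlock T μ r j →
      Star (λ a b → InBlock T μ r a × InBlock T μ r b × DriftHyp S n T a b) i j

  ACadet : List ℤ → ℕ → Tree m → Marking → Set
  ACadet S n T μ =
    ∀ i j (s : Fin (suc m)) → IsCadet T i j s → ¬ InMu μ i j →
      (toℕ s ≡ 0 × i < j)
      ⊎ (∃[ i' ] ∃[ j' ] (InBlock T μ i i' × InBlock T μ j j' × DriftHyp S n T i' j'))

InTbarA : (S : List ℤ) (m n : ℕ) → Tree m → Marking → Set
InTbarA S m n T μ = IsMarked m n T μ × AConnected S n T μ × ACadet S n T μ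

module _ {m : ℕ} where

  IsTop : Tree m → Marking → ℕ → ℕ → Set
  IsTop T μ r a = InBlock T μ r a × (∀ j → InBlock T μ r j → IsPrefix (addr T a) (addr T j))

  InShadow : Tree m → Marking → ℕ → ℕ → Set
  InShadow T μ r x =
    ∃[ a ] ∃[ j ] (IsTop T μ r a × InBlock T μ r j × x ≡ drift T j ∸ drift T a)

  IsMaxShadow : Tree m → Marking → ℕ → ℕ → Set
  IsMaxShadow T μ r M = InShadow T μ r M × (∀ e → InShadow T μ r e → e ≤ M)

  InStart : Tree m → Marking → ℕ → ℕ → Set
  InStart T μ r d = 1 ≤ d × d < m × InShadow T μ r d

  InEnd : Tree m → Marking → ℕ → ℕ → Set
  InEnd T μ r d =
    1 ≤ d × d < m × ∃[ M ] ∃[ e ] (IsMaxShadow T μ r M × InShadow T μ r e × d ≡ M ∸ e)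

InC : List ℤ → ℕ → (ℕ → Set) → (ℕ → Set) → ℕ → Set
InC S m V W s =
  s ≡ 0
  ⊎ (1 ≤ s × s ≤ m × ∃[ d ] ∃[ d' ] ((d ≡ 0 ⊎ V d) × (d' ≡ 0 ⊎ W d') × + (s + d + d') ∈ S))

module _ {m : ℕ} where

  BigBlock : Tree m → Marking → ℕ → Set
  BigBlock T μ r = ∃[ k ] (InBlock T μ r k × k ≢ r)

  Cond1 : List ℤ → Tree m → Marking → Set
  Cond1 S T μ =
    ∀ i j (s : Fin (suc m)) → IsCadet T i j s → ¬ InMu μ i j →
      InC S m (InEnd T μ j) (InStart T μ i) (toℕ s)

  Cond2 : List ℤ → Tree m → Marking → Set
  Cond2 S T μ =
    ∀ i j (s : Fin (suc m)) → IsCadet T i j s → ¬ InMu μ i j →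
      InC S m (InEnd T μ j) (InStart T μ i) (toℕ s)
      × (0 < toℕ s ⊎ BigBlock T μ j ⊎ BigBlock T μ i ⊎ i < j)

-- Let i be the s-cadet of j with {i,j} ∉ μ, and let B ∋ j and B′ ∋ i be their blocks. Marked edges
-- are cadet edges and a node has at most one cadet, so B is a chain of ancestors of j (j is its
-- deepest node), while i is the top of B′. Hence for j′ ∈ B and i′ ∈ B′
--   drift(i′) − drift(j′) = s + d + d′,  d = drift(j) − drift(j′),  d′ = drift(i′) − drift(i),
-- and, below m, d ranges exactly over {0} ∪ end(B) and d′ over {0} ∪ start(B′). The blocks are
-- disjoint and S = −S, so a hyperplane of A_S^n joins B′ to B iff some such s + d + d′ lies in S.
-- For s > 0 this forces s + d + d′ ≤ max S = m, hence d, d′ < m, which is s ∈ C_S^{end(B),start(B′)}.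
-- For s = 0, i and j themselves are joined iff 0 ∈ S; if 0 ∉ S the blocks are joined iff one of
-- them has a second node, since by A-connectivity j (or i) then has a hyperplane of A to another
-- node of its block, and it transfers to the other endpoint because drift(i) = drift(j).
module Submission where

open import Defs
open import Data.Nat using (ℕ; _+_; _≤_)
open import Data.Integer as ℤ using (ℤ; +_; -_)
open import Data.List using (List)
open import Data.List.Membership.Propositional using (_∈_; _∉_)
open import Data.Product using (_×_)
open import Function.Bundles using (_⇔_)

open import Data.Bool using (true; false)
open import Data.Fin as Fin using (Fin; toℕ)
import Data.Fin.Properties as Fin
import Data.Integer.Properties as ℤ
open import Data.List as List using ([]; _∷_; _++_; _∷ʳ_; length; map)
import Data.List.Properties as List
open import Data.List.Membership.Propositional.Properties using (∈-++⁺ˡ; ∈-++⁺ʳ; ∈-++⁻; ∈-map⁻; ∈-upTo⁻)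
open import Data.List.Relation.Binary.Permutation.Propositional using (↭-sym; ↭⇒↭ₛ)
open import Data.List.Relation.Binary.Permutation.Propositional.Properties using (∈-resp-↭)
import Data.List.Relation.Unary.All as All
import Data.List.Relation.Unary.All.Properties as All
open import Data.List.Relation.Unary.AllPairs using ([]; _∷_)
open import Data.List.Relation.Unary.Any using (here; there)
open import Data.List.Relation.Unary.Unique.Propositional using (Unique)
open import Data.List.Relation.Unary.Unique.Propositional.Properties as Unique using (Unique[x∷xs]⇒x∉xs)
open import Data.List.Reverse using (Reverse; []; _∶_∶ʳ_; reverseView)
open import Data.Maybe using (just; nothing)
open import Data.Nat as ℕ using (zero; suc; _∸_; _<_; z≤n; s≤s; z<s)
open import Data.Nat.ListAction using (sum)
open import Data.Nat.ListAction.Properties using (sum-++)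
open import Data.Nat.Properties as ℕ
  using (≤-trans; <-≤-trans; ≤-<-trans; ≤-antisym; m≤m+n; m<m+n; m+[n∸m]≡n; m+n∸m≡n)
open import Data.Nat.Solver using (module +-*-Solver)
open import Data.Product using (∃-syntax; _,_; proj₁; proj₂)
open import Data.Product.Properties using (≡-dec)
open import Data.Sum as Sum using (_⊎_; inj₁; inj₂)
open import Data.Vec using (Vec; []; _∷_; lookup)
open import Function.Bundles using (Equivalence; mk⇔)
open import Function.Construct.Composition using (_⇔-∘_)
open import Relation.Binary.Construct.Closure.ReflexiveTransitive using (ε; _◅_)
open import Relation.Binary.Definitions using (tri<; tri≈; tri>)
open import Relation.Binary.PropositionalEquality
open import Data.List.Relation.Binary.Permutation.Setoid.Properties (setoid ℕ) using (Unique-resp-↭)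
open import Relation.Nullary using (¬_; Dec; yes; no; contradiction; _⊎-dec_)

Unique-++⁻ : ∀ {a} {A : Set a} (xs : List A) {ys : List A} →
  Unique (xs ++ ys) → Unique xs × Unique ys × (∀ {x} → x ∈ ys → x ∉ xs)
Unique-++⁻ [] u = [] , u , λ _ ()
Unique-++⁻ (x ∷ xs) (x∉ ∷ u) with uxs , uys , disjoint ← Unique-++⁻ xs u =
  All.++⁻ˡ xs x∉ ∷ uxs , uys ,
  λ { y∈ys (here refl) → All.lookup (All.++⁻ʳ xs x∉) y∈ys refl
    ; y∈ys (there y∈xs) → disjoint y∈ys y∈xs }

zero⊎positive : ∀ k → k ≡ 0 ⊎ 0 < k
zero⊎positive zero = inj₁ refl
zero⊎positive (suc k) = inj₂ z<s

[k+d∸a]∸[k∸a]≡d : ∀ {a k} d → a ≤ k → (k + d ∸ a) ∸ (k ∸ a) ≡ d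
[k+d∸a]∸[k∸a]≡d {a} {k} d a≤k = trans (cong (_∸ (k ∸ a)) (ℕ.+-∸-comm d a≤k)) (m+n∸m≡n (k ∸ a) d)

a+e+[r∸a∸e]≡r : ∀ {a e r} → a + e ≤ r → a + e + (r ∸ a ∸ e) ≡ r
a+e+[r∸a∸e]≡r {a} {e} {r} a+e≤r = trans (cong (λ x → a + e + x) (ℕ.∸-+-assoc r a e)) (m+[n∸m]≡n a+e≤r)

chain-offsets : ∀ {b c a a′} d s d′ → b + d ≡ c → c + s ≡ a → a + d′ ≡ a′ → b + (s + d + d′) ≡ a′
chain-offsets {b} d s d′ refl refl refl =
  solve 4 (λ b d s d′ → b :+ (s :+ d :+ d′) := b :+ d :+ s :+ d′) refl b d s d′
  where open +-*-Solver

+[m+k]-+m≡+k : ∀ m k → + (m + k) ℤ.- + m ≡ + k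
+[m+k]-+m≡+k m k = trans (ℤ.[+m]-[+n]≡m⊖n (m + k) m) (trans (ℤ.⊖-≥ (m≤m+n m k)) (cong +_ (m+n∸m≡n m k)))

+m-+n≡-[+n-+m] : ∀ m n → + m ℤ.- + n ≡ - (+ n ℤ.- + m)
+m-+n≡-[+n-+m] m n =
  trans (ℤ.[+m]-[+n]≡m⊖n m n) (trans (ℤ.⊖-swap m n) (cong -_ (sym (ℤ.[+m]-[+n]≡m⊖n n m))))

module _ {m : ℕ} where

  weight : Addr m → ℕ
  weight α = sum (map toℕ α)

  weight-++ : (α β : Addr m) → weight (α ++ β) ≡ weight α + weight β
  weight-++ α β = trans (cong sum (List.map-++ toℕ α β)) (sum-++ (map toℕ α) (map toℕ β))

  length-∷ʳ : (γ : Addr m) (c : Fin (suc m)) → length (γ ∷ʳ c) ≡ suc (length γ)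
  length-∷ʳ [] c = refl
  length-∷ʳ (_ ∷ γ) c = cong suc (length-∷ʳ γ c)

  length-++-∷-< : (α : Addr m) {a : Fin (suc m)} (β : Addr m) → length α < length (α ++ a ∷ β)
  length-++-∷-< α {a} β rewrite List.length-++ α {a ∷ β} = m<m+n (length α) z<s

  prefix-refl : (α : Addr m) → IsPrefix α α
  prefix-refl α = [] , List.++-identityʳ α

  prefix-++⁻ : {γ β α : Addr m} → IsPrefix (γ ++ β) α → IsPrefix γ α
  prefix-++⁻ {γ} {β} (δ , e) = β ++ δ , trans (sym (List.++-assoc γ β δ)) e

  prefix-length : {α β : Addr m} → IsPrefix α β → length α ≤ length β
  prefix-length {α} (δ , refl) rewrite List.length-++ α {δ} = m≤m+n (length α) (length δ)

  prefix-antisym : {α β : Addr m} → IsPrefix α β → IsPrefix β α → α ≡ β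
  prefix-antisym {α} (δ , refl) (δ′ , e)
    with refl ← List.++-conicalˡ δ δ′
                  (List.++-identityʳ-unique α (sym (trans (sym (List.++-assoc α δ δ′)) e)))
    = sym (List.++-identityʳ α)

  common-prefix-by-length : {γ α ρ : Addr m} → IsPrefix γ ρ → IsPrefix α ρ → length γ ≤ length α →
    IsPrefix γ α
  common-prefix-by-length {[]} {α} _ _ _ = α , refl
  common-prefix-by-length {c ∷ γ} {[]} _ _ ()
  common-prefix-by-length {c ∷ γ} {a ∷ α} (δ , refl) (δ′ , e) (s≤s le)
    with refl , e′ ← List.∷-injective e
    with δ″ , refl ← common-prefix-by-length (δ , refl) (δ′ , e′) le
    = δ″ , refl

  lcp-prefixˡ : (α β : Addr m) → IsPrefix (lcp α β) α
  lcp-prefixˡ (a ∷ α) (b ∷ β) with a Fin.≟ b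
  ... | yes _ = let δ , e = lcp-prefixˡ α β in δ , cong (a ∷_) e
  ... | no _ = a ∷ α , refl
  lcp-prefixˡ [] _ = [] , refl
  lcp-prefixˡ (a ∷ α) [] = a ∷ α , refl

  lcp-prefixʳ : (α β : Addr m) → IsPrefix (lcp α β) β
  lcp-prefixʳ (a ∷ α) (b ∷ β) with a Fin.≟ b
  ... | yes refl = let δ , e = lcp-prefixʳ α β in δ , cong (a ∷_) e
  ... | no _ = b ∷ β , refl
  lcp-prefixʳ [] β = β , refl
  lcp-prefixʳ (a ∷ α) [] = [] , refl

  lcp-of-prefix : {α β : Addr m} → IsPrefix β α → lcp α β ≡ β
  lcp-of-prefix {[]} {[]} _ = refl
  lcp-of-prefix {a ∷ α} {[]} _ = refl
  lcp-of-prefix {a ∷ α} {b ∷ β} (δ , e) with refl , e′ ← List.∷-injective e | a Fin.≟ a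
  ... | yes _ = cong (a ∷_) (lcp-of-prefix (δ , e′))
  ... | no a≢a = contradiction refl a≢a

  lcp-maximal : {α β α′ β′ : Addr m} {a b : Fin (suc m)} →
    lcp α β ++ a ∷ α′ ≡ α → lcp α β ++ b ∷ β′ ≡ β → a ≢ b
  lcp-maximal {x ∷ α} {y ∷ β} eα eβ with x Fin.≟ y
  ... | no x≢y = λ { refl → x≢y (trans (sym (proj₁ (List.∷-injective eα))) (proj₁ (List.∷-injective eβ))) }
  ... | yes refl = lcp-maximal (proj₂ (List.∷-injective eα)) (proj₂ (List.∷-injective eβ))
  lcp-maximal {[]} () _
  lcp-maximal {_ ∷ _} {[]} _ ()

module _ {m : ℕ} where

  subtree-leaf : (α : Addr m) → subtree leaf α ≡ leaf
  subtree-leaf [] = refl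
  subtree-leaf (_ ∷ _) = refl

  subtree-++ : (t : Tree m) (α β : Addr m) → subtree t (α ++ β) ≡ subtree (subtree t α) β
  subtree-++ t [] β = refl
  subtree-++ leaf (a ∷ α) β = sym (subtree-leaf β)
  subtree-++ (node _ cs) (a ∷ α) β = subtree-++ (lookup cs a) α β

  subtree≡node⇒∈labels : (t : Tree m) (α : Addr m) {i : ℕ} {cs : Vec (Tree m) (suc m)} →
    subtree t α ≡ node i cs → i ∈ labels t
  subtree≡node⇒∈labelsV : ∀ {k} (ts : Vec (Tree m) k) (a : Fin k) (α : Addr m) {i cs} →
    subtree (lookup ts a) α ≡ node i cs → i ∈ labelsV ts
  subtree≡node⇒∈labels t [] refl = here refl
  subtree≡node⇒∈labels (node j ts) (a ∷ α) e = there (subtree≡node⇒∈labelsV ts a α e)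
  subtree≡node⇒∈labelsV (t ∷ ts) Fin.zero α e = ∈-++⁺ˡ (subtree≡node⇒∈labels t α e)
  subtree≡node⇒∈labelsV (t ∷ ts) (Fin.suc a) α e = ∈-++⁺ʳ (labels t) (subtree≡node⇒∈labelsV ts a α e)

  ∈labels⇒subtree≡node : (t : Tree m) {i : ℕ} → i ∈ labels t → ∃[ α ] ∃[ cs ] (subtree t α ≡ node i cs)
  ∈labelsV⇒subtree≡node : ∀ {k} (ts : Vec (Tree m) k) {i : ℕ} → i ∈ labelsV ts →
    ∃[ a ] ∃[ α ] ∃[ cs ] (subtree (lookup ts a) α ≡ node i cs)
  ∈labels⇒subtree≡node (node j ts) (here refl) = [] , ts , refl
  ∈labels⇒subtree≡node (node j ts) (there i∈) =
    let a , α , cs , e = ∈labelsV⇒subtree≡node ts i∈ in a ∷ α , cs , e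
  ∈labelsV⇒subtree≡node (t ∷ ts) i∈ with ∈-++⁻ (labels t) i∈
  ... | inj₁ i∈t = let α , cs , e = ∈labels⇒subtree≡node t i∈t in Fin.zero , α , cs , e
  ... | inj₂ i∈ts = let a , α , cs , e = ∈labelsV⇒subtree≡node ts i∈ts in Fin.suc a , α , cs , e

  find-∉ : {i : ℕ} (t : Tree m) → i ∉ labels t → find i t ≡ nothing
  findV-∉ : {i : ℕ} → ∀ {k} (ts : Vec (Tree m) k) → i ∉ labelsV ts → findV i ts ≡ nothing
  find-∉ leaf _ = refl
  find-∉ {i} (node j ts) i∉ with j ℕ.≡ᵇ i | ℕ.≡ᵇ⇒≡ j i
  ... | true | j≡i = contradiction (here (sym (j≡i _))) i∉
  ... | false | _ rewrite findV-∉ ts (λ i∈ts → i∉ (there i∈ts)) = refl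
  findV-∉ [] _ = refl
  findV-∉ (t ∷ ts) i∉ rewrite find-∉ t (λ i∈t → i∉ (∈-++⁺ˡ i∈t))
                           | findV-∉ ts (λ i∈ts → i∉ (∈-++⁺ʳ (labels t) i∈ts)) = refl

  find-subtree : (t : Tree m) (α : Addr m) {i : ℕ} {cs : Vec (Tree m) (suc m)} →
    Unique (labels t) → subtree t α ≡ node i cs → find i t ≡ just α
  findV-subtree : ∀ {k} (ts : Vec (Tree m) k) (a : Fin k) (α : Addr m) {i cs} →
    Unique (labelsV ts) → subtree (lookup ts a) α ≡ node i cs → findV i ts ≡ just (a , α)
  find-subtree (node j ts) [] _ refl with j ℕ.≡ᵇ j | ℕ.≡⇒≡ᵇ j j refl
  ... | true | _ = refl
  ... | false | ()
  find-subtree (node j ts) (a ∷ α) {i} (j∉ ∷ u) e with j ℕ.≡ᵇ i | ℕ.≡ᵇ⇒≡ j i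
  ... | true | j≡i = contradiction (subst (_∈ labelsV ts) (sym (j≡i _)) (subtree≡node⇒∈labelsV ts a α e))
                                   (Unique[x∷xs]⇒x∉xs (j∉ ∷ u))
  ... | false | _ rewrite findV-subtree ts a α u e = refl
  findV-subtree (t ∷ ts) Fin.zero α u e rewrite find-subtree t α (proj₁ (Unique-++⁻ (labels t) u)) e = refl
  findV-subtree (t ∷ ts) (Fin.suc a) α u e
    with _ , uts , disjoint ← Unique-++⁻ (labels t) u
    rewrite find-∉ t (disjoint (subtree≡node⇒∈labelsV ts a α e))
          | findV-subtree ts a α uts e = refl

module LabelledTree {m : ℕ} (T : Tree m) (distinct : Unique (labels T)) where

  addr-subtree : {α : Addr m} {i : ℕ} {cs : Vec (Tree m) (suc m)} → subtree T α ≡ node i cs → addr T i ≡ α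
  addr-subtree {α} e rewrite find-subtree T α distinct e = refl

  subtree-addr : {i : ℕ} → Node T i → ∃[ cs ] (subtree T (addr T i) ≡ node i cs)
  subtree-addr i∈ with α , cs , e ← ∈labels⇒subtree≡node T i∈ rewrite addr-subtree {α} e = cs , e

  addr-injective : {v w : ℕ} → Node T v → Node T w → addr T v ≡ addr T w → v ≡ w
  addr-injective v∈ w∈ e with _ , ev ← subtree-addr v∈ | _ , ew ← subtree-addr w∈
    with refl ← trans (sym ev) (trans (cong (subtree T) e) ew) = refl

  node-at-prefix : {j : ℕ} {γ : Addr m} → Node T j → IsPrefix γ (addr T j) → ∃[ a ] (Node T a × addr T a ≡ γ)
  node-at-prefix {j} {γ} j∈ (δ , e) with subtree T γ in eγ
  ... | node a _ = a , subtree≡node⇒∈labels T γ eγ , addr-subtree eγ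
  ... | leaf = contradiction leaf≡node λ ()
    where
    open ≡-Reasoning
    leaf≡node : leaf ≡ node j (proj₁ (subtree-addr j∈))
    leaf≡node = begin
      leaf                       ≡⟨ sym (subtree-leaf δ) ⟩
      subtree leaf δ             ≡⟨ cong (λ t → subtree t δ) eγ ⟨
      subtree (subtree T γ) δ    ≡⟨ subtree-++ T γ δ ⟨
      subtree T (γ ++ δ)         ≡⟨ cong (subtree T) e ⟩
      subtree T (addr T j)       ≡⟨ proj₂ (subtree-addr j∈) ⟩
      node j _                   ∎

  child-addr : {i j : ℕ} {s : Fin (suc m)} → IsChild T i j s → addr T i ≡ addr T j ∷ʳ s
  child-addr (_ , _ , e) = addr-subtree e

  child-node : {i j : ℕ} {s : Fin (suc m)} → IsChild T i j s → Node T i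
  child-node {j = j} {s} (_ , _ , e) = subtree≡node⇒∈labels T (addr T j ∷ʳ s) e

  addr⇒child : {a u : ℕ} {c : Fin (suc m)} → Node T a → Node T u → addr T a ≡ addr T u ∷ʳ c → IsChild T a u c
  addr⇒child a∈ u∈ e with cs , ea ← subtree-addr a∈ = u∈ , cs , subst (λ α → subtree T α ≡ _) e ea

  child-unique : {v w u : ℕ} {b : Fin (suc m)} → IsChild T v u b → IsChild T w u b → v ≡ w
  child-unique (_ , _ , ev) (_ , _ , ew) with refl ← trans (sym ev) ew = refl

  child-deeper : {i j : ℕ} {s : Fin (suc m)} → IsChild T i j s → length (addr T j) < length (addr T i)
  child-deeper {j = j} ch =
    subst (λ α → length (addr T j) < length α) (sym (child-addr ch)) (length-++-∷-< (addr T j) [])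

  cadet-index-unique : {v w u : ℕ} {b a : Fin (suc m)} → IsCadet T v u b → IsCadet T w u a → b ≡ a
  cadet-index-unique {b = b} {a} ((_ , _ , ev) , later-v) ((_ , _ , ew) , later-w) with Fin.<-cmp b a
  ... | tri≈ _ b≡a _ = b≡a
  ... | tri< b<a _ _ = contradiction (trans (sym ew) (later-v a b<a)) λ ()
  ... | tri> _ _ a<b = contradiction (trans (sym ev) (later-w b a<b)) λ ()

  drift-child : {i j : ℕ} {s : Fin (suc m)} → IsChild T i j s → drift T i ≡ drift T j + toℕ s
  drift-child {i} {j} {s} ch = begin
    drift T i                  ≡⟨ cong weight (child-addr ch) ⟩
    weight (addr T j ∷ʳ s)     ≡⟨ weight-++ (addr T j) (s ∷ []) ⟩
    drift T j + (toℕ s + 0)    ≡⟨ cong (λ k → drift T j + k) (ℕ.+-identityʳ (toℕ s)) ⟩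
    drift T j + toℕ s          ∎
    where open ≡-Reasoning

  drift-mono : {x y : ℕ} → IsPrefix (addr T x) (addr T y) → drift T x ≤ drift T y
  drift-mono {x} (δ , e) =
    subst (drift T x ≤_) (trans (sym (weight-++ (addr T x) δ)) (cong weight e)) (m≤m+n (drift T x) (weight δ))

module Blocks {m : ℕ} (T : Tree m) (distinct : Unique (labels T)) (μ : Marking)
              (μ-cadet : ∀ a b → (a , b) ∈ μ → CadetEdge T a b) where

  open LabelledTree T distinct

  InMu? : ∀ v u → Dec (InMu μ v u)
  InMu? v u = (v , u) ∈? μ ⊎-dec (u , v) ∈? μ
    where open import Data.List.Membership.DecPropositional (≡-dec ℕ._≟_ ℕ._≟_) using (_∈?_)

  marked-child⇒cadet : {v u : ℕ} {b : Fin (suc m)} → IsChild T v u b → InMu μ v u → IsCadet T v u b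
  marked-child⇒cadet ch marked with cadet-edge marked
    where
    cadet-edge : ∀ {v u} → InMu μ v u → CadetEdge T v u
    cadet-edge {v} {u} (inj₁ vu∈μ) = μ-cadet v u vu∈μ
    cadet-edge {v} {u} (inj₂ uv∈μ) = Sum.swap (μ-cadet u v uv∈μ)
  ... | inj₁ (_ , cd)
    with refl ← List.∷ʳ-injectiveʳ _ _ (trans (sym (child-addr (proj₁ cd))) (child-addr ch)) = cd
  ... | inj₂ (_ , cd) = contradiction (child-deeper ch) (ℕ.<-asym (child-deeper (proj₁ cd)))

  edge-toward : {k : ℕ} {ρ δ : Addr m} {b : Fin (suc m)} → Node T k → ρ ++ b ∷ δ ≡ addr T k →
    ∃[ v ] ∃[ u ] (IsChild T v u b × addr T u ≡ ρ × IsPrefix (addr T v) (addr T k) ×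
                   length ρ < length (addr T v))
  edge-toward {ρ = ρ} {δ} {b} k∈ e
    with v , v∈ , ev ← node-at-prefix k∈ (δ , trans (List.++-assoc ρ (b ∷ []) δ) e)
       | u , u∈ , eu ← node-at-prefix k∈ (b ∷ δ , e)
    = v , u , addr⇒child v∈ u∈ (trans ev (cong (_∷ʳ b) (sym eu))) , eu ,
      (δ , trans (cong (_++ δ) ev) (trans (List.++-assoc ρ (b ∷ []) δ) e)) ,
      subst (λ α → length ρ < length α) (sym ev) (length-++-∷-< ρ [])

  child-block-below : {i j i′ : ℕ} {s : Fin (suc m)} → IsChild T i j s → ¬ InMu μ i j →
    InBlock T μ i i′ → IsPrefix (addr T i) (addr T i′)
  child-block-below ch free (_ , inj₁ refl) = prefix-refl _
  child-block-below {i} {j} {i′} {s} ch free (_ , inj₂ marked) with lcp-prefixˡ (addr T i) (addr T i′)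
  ... | [] , e = subst (λ α → IsPrefix α (addr T i′)) (trans (sym (List.++-identityʳ _)) e)
                       (lcp-prefixʳ (addr T i) (addr T i′))
  ... | a ∷ α , e = contradiction (marked i j s ch (inj₁ (prefix-refl _) , lcp<i)) free
    where
    lcp<i : length (lcp (addr T i) (addr T i′)) < length (addr T i)
    lcp<i = subst (λ β → length (lcp (addr T i) (addr T i′)) < length β) e
                  (length-++-∷-< (lcp (addr T i) (addr T i′)) {a} α)

  -- A marked edge leaving the path from the root to j would be a second cadet of its parent.
  parent-block-above : {i j k : ℕ} {s : Fin (suc m)} → IsCadet T i j s → ¬ InMu μ i j →
    InBlock T μ j k → IsPrefix (addr T k) (addr T j)
  parent-block-above cd free (_ , inj₁ refl) = prefix-refl _
  parent-block-above {i} {j} {k} {s} cd@(ch@(j∈ , _) , _) free (k∈ , inj₂ marked)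
    with lcp-prefixʳ (addr T j) (addr T k) | lcp-prefixˡ (addr T j) (addr T k)
  ... | [] , e | _ = subst (λ α → IsPrefix α (addr T j)) (trans (sym (List.++-identityʳ _)) e)
                           (lcp-prefixˡ (addr T j) (addr T k))
  ... | b ∷ δ , e | [] , ej
    with v , u , chv , eu , v⊑k , lcp<v ← edge-toward k∈ e
    with refl ← addr-injective (proj₁ chv) j∈ (trans eu (trans (sym (List.++-identityʳ _)) ej))
    with refl ← cadet-index-unique (marked-child⇒cadet chv (marked v j b chv (inj₂ v⊑k , lcp<v))) cd
    with refl ← child-unique chv ch
    = contradiction (marked i j s chv (inj₂ v⊑k , lcp<v)) free
  ... | b ∷ δ , e | a ∷ α , ej
    with v , u , chv , eu , v⊑k , lcp<v ← edge-toward k∈ e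
       | w , u′ , chw , eu′ , w⊑j , lcp<w ← edge-toward j∈ ej
    with refl ← addr-injective (proj₁ chw) (proj₁ chv) (trans eu′ (sym eu))
    = contradiction (cadet-index-unique (marked-child⇒cadet chw (marked w u a chw (inj₁ w⊑j , lcp<w)))
                                        (marked-child⇒cadet chv (marked v u b chv (inj₂ v⊑k , lcp<v))))
                    (lcp-maximal ej e)

  MarkedSegment : Addr m → Addr m → Set
  MarkedSegment γ α =
    ∀ v u c → IsChild T v u c → IsPrefix (addr T v) α → length γ < length (addr T v) → InMu μ v u

  UnmarkedAbove : ℕ → Set
  UnmarkedAbove a = addr T a ≡ [] ⊎ ∃[ u ] ∃[ c ] (IsChild T a u c × ¬ InMu μ a u)

  -- Walk up from j along marked edges; the node where the walk stops is the top of j's block.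
  climb : {j : ℕ} → Node T j → (γ : Addr m) → Reverse γ → IsPrefix γ (addr T j) → MarkedSegment γ (addr T j) →
    ∃[ a ] (Node T a × IsPrefix (addr T a) (addr T j) × MarkedSegment (addr T a) (addr T j) × UnmarkedAbove a)
  climb {j} j∈ .[] [] γ⊑j segment with a , a∈ , ea ← node-at-prefix j∈ γ⊑j =
    a , a∈ , subst (λ α → IsPrefix α (addr T j)) (sym ea) γ⊑j ,
    subst (λ α → MarkedSegment α (addr T j)) (sym ea) segment , inj₁ ea
  climb {j} j∈ .(γ ∷ʳ c) (γ ∶ r ∶ʳ c) γc⊑j segment
    with a , a∈ , ea ← node-at-prefix j∈ γc⊑j
       | u , u∈ , eu ← node-at-prefix j∈ (prefix-++⁻ γc⊑j)
    with InMu? a u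
  ... | no free =
    a , a∈ , subst (λ α → IsPrefix α (addr T j)) (sym ea) γc⊑j ,
    subst (λ α → MarkedSegment α (addr T j)) (sym ea) segment ,
    inj₂ (u , c , addr⇒child a∈ u∈ (trans ea (cong (_∷ʳ c) (sym eu))) , free)
  ... | yes marked = climb j∈ γ r (prefix-++⁻ γc⊑j) segment′
    where
    segment′ : MarkedSegment γ (addr T j)
    segment′ v u′ c′ chv v⊑j γ<v with length (γ ∷ʳ c) ℕ.<? length (addr T v)
    ... | yes γc<v = segment v u′ c′ chv v⊑j γc<v
    ... | no γc≮v
      with ev ← prefix-antisym
                  (common-prefix-by-length v⊑j γc⊑j (ℕ.≮⇒≥ γc≮v))
                  (common-prefix-by-length γc⊑j v⊑j (subst (_≤ length (addr T v)) (sym (length-∷ʳ γ c)) γ<v))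
      with refl ← addr-injective (child-node chv) a∈ (trans ev (sym ea))
      with refl ← addr-injective (proj₁ chv) u∈
                    (trans (List.∷ʳ-injectiveˡ _ _ (trans (sym (child-addr chv)) ev)) (sym eu))
      = marked

  top-of-block : {j : ℕ} → Node T j → (∀ k → InBlock T μ j k → IsPrefix (addr T k) (addr T j)) →
    ∃[ a ] IsTop T μ j a
  top-of-block {j} j∈ above
    with a , a∈ , a⊑j , segment , unmarked
           ← climb j∈ (addr T j) (reverseView _) (prefix-refl _)
                   (λ _ _ _ _ v⊑j j<v → contradiction (prefix-length v⊑j) (ℕ.<⇒≱ j<v))
    = a , (a∈ , inj₂ on-path) , below
    where
    on-path : ∀ v u c → IsChild T v u c → OnPath T j a v → InMu μ v u
    on-path v u c ch (v⊑j⊎v⊑a , lcp<v)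
      with subst (λ γ → length γ < length (addr T v)) (lcp-of-prefix a⊑j) lcp<v
    ... | a<v with v⊑j⊎v⊑a
    ... | inj₁ v⊑j = segment v u c ch v⊑j a<v
    ... | inj₂ v⊑a = contradiction (prefix-length v⊑a) (ℕ.<⇒≱ a<v)

    below : ∀ k → InBlock T μ j k → IsPrefix (addr T a) (addr T k)
    below k k∈B with length (addr T a) ℕ.≤? length (addr T k)
    ... | yes a≤k = common-prefix-by-length a⊑j (above k k∈B) a≤k
    ... | no a≰k = contradiction k∈B (strictly-above unmarked (ℕ.≰⇒> a≰k))
      where
      strictly-above : ∀ {k} → UnmarkedAbove a → length (addr T k) < length (addr T a) → ¬ InBlock T μ j k
      strictly-above {k} (inj₁ a≡[]) k<a _ =
        contradiction (subst (λ γ → length (addr T k) < length γ) a≡[] k<a) λ ()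
      strictly-above (inj₂ _) k<a (_ , inj₁ refl) = contradiction (prefix-length a⊑j) (ℕ.<⇒≱ k<a)
      strictly-above {k} (inj₂ (u , c , ch , free)) k<a (_ , inj₂ marked) =
        free (marked a u c ch (inj₁ a⊑j , ≤-<-trans (prefix-length (lcp-prefixʳ (addr T j) (addr T k))) k<a))

  top-drift-unique : {r a a′ : ℕ} → IsTop T μ r a → IsTop T μ r a′ → drift T a ≡ drift T a′
  top-drift-unique (a∈B , a-top) (a′∈B , a′-top) = cong weight (prefix-antisym (a-top _ a′∈B) (a′-top _ a∈B))

  InShadow⁺ : {r a k x : ℕ} → IsTop T μ r a → InBlock T μ r k → drift T a + x ≡ drift T k → InShadow T μ r x
  InShadow⁺ {a = a} {x = x} top k∈B e =
    _ , _ , top , k∈B , sym (trans (cong (_∸ drift T a) (sym e)) (m+n∸m≡n (drift T a) x))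

  InShadow⁻ : {r a x : ℕ} → IsTop T μ r a → InShadow T μ r x →
    ∃[ k ] (InBlock T μ r k × drift T a + x ≡ drift T k)
  InShadow⁻ top (a′ , k , top′ , k∈B , refl) rewrite top-drift-unique top top′ =
    k , k∈B , m+[n∸m]≡n (drift-mono (proj₂ top′ k k∈B))

  IsMaxShadow-unique : {r M M′ : ℕ} → IsMaxShadow T μ r M → IsMaxShadow T μ r M′ → M ≡ M′
  IsMaxShadow-unique (M∈ , M-max) (M′∈ , M′-max) = ≤-antisym (M′-max _ M∈) (M-max _ M′∈)

  module BlockWithBottom {r a : ℕ} (r∈ : Node T r) (top : IsTop T μ r a)
                         (bottom : ∀ k → InBlock T μ r k → IsPrefix (addr T k) (addr T r)) where

    r∈B : InBlock T μ r r
    r∈B = r∈ , inj₁ refl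

    a≤ : ∀ {k} → InBlock T μ r k → drift T a ≤ drift T k
    a≤ k∈B = drift-mono (proj₂ top _ k∈B)

    ≤r : ∀ {k} → InBlock T μ r k → drift T k ≤ drift T r
    ≤r k∈B = drift-mono (bottom _ k∈B)

    max-shadow : IsMaxShadow T μ r (drift T r ∸ drift T a)
    max-shadow = InShadow⁺ top r∈B (m+[n∸m]≡n (a≤ r∈B)) , max
      where
      max : ∀ e → InShadow T μ r e → e ≤ drift T r ∸ drift T a
      max e e∈ with k , k∈B , a+e≡k ← InShadow⁻ top e∈ =
        ℕ.m+n≤o⇒m≤o∸n e (subst (_≤ drift T r) (trans (sym a+e≡k) (ℕ.+-comm (drift T a) e)) (≤r k∈B))

    InEnd⁺ : {k d : ℕ} → InBlock T μ r k → drift T k + d ≡ drift T r → 1 ≤ d → d < m → InEnd T μ r d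
    InEnd⁺ {k} {d} k∈B k+d≡r 1≤d d<m =
      1≤d , d<m , _ , _ , max-shadow , InShadow⁺ top k∈B (m+[n∸m]≡n (a≤ k∈B)) ,
      sym (subst (λ x → (x ∸ drift T a) ∸ (drift T k ∸ drift T a) ≡ d) k+d≡r ([k+d∸a]∸[k∸a]≡d d (a≤ k∈B)))

    InEnd⁻ : {d : ℕ} → InEnd T μ r d → ∃[ k ] (InBlock T μ r k × drift T k + d ≡ drift T r)
    InEnd⁻ (_ , _ , M , e , M-max , e∈ , refl)
      with refl ← IsMaxShadow-unique M-max max-shadow
      with k , k∈B , a+e≡k ← InShadow⁻ top e∈
      = k , k∈B , subst (λ x → x + (drift T r ∸ drift T a ∸ e) ≡ drift T r) a+e≡k
                        (a+e+[r∸a∸e]≡r {drift T a} {e} (subst (_≤ drift T r) (sym a+e≡k) (≤r k∈B)))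

module _ {S : List ℤ} {n : ℕ} where

  HypIn-swap : {p q : ℕ} {x : ℤ} → HypIn S n p q x → HypIn S n q p (- x)
  HypIn-swap {x = x} (inj₁ (1≤p , p<q , q≤n , x∈S)) =
    inj₂ (1≤p , p<q , q≤n , subst (_∈ S) (sym (ℤ.neg-involutive x)) x∈S)
  HypIn-swap (inj₂ (1≤q , q<p , p≤n , -x∈S)) = inj₁ (1≤q , q<p , p≤n , -x∈S)

  module _ (S-sym : ∀ s → s ∈ S → - s ∈ S) where

    HypIn⇒∈ : {p q : ℕ} {x : ℤ} → HypIn S n p q x → x ∈ S
    HypIn⇒∈ (inj₁ (_ , _ , _ , x∈S)) = x∈S
    HypIn⇒∈ {x = x} (inj₂ (_ , _ , _ , -x∈S)) = subst (_∈ S) (ℤ.neg-involutive x) (S-sym (- x) -x∈S)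

    HypIn⁺ : {p q : ℕ} {x : ℤ} → 1 ≤ p × p ≤ n → 1 ≤ q × q ≤ n → p ≢ q → x ∈ S → HypIn S n p q x
    HypIn⁺ {p} {q} {x} (1≤p , p≤n) (1≤q , q≤n) p≢q x∈S with ℕ.<-cmp p q
    ... | tri< p<q _ _ = inj₁ (1≤p , p<q , q≤n , x∈S)
    ... | tri≈ _ p≡q _ = contradiction p≡q p≢q
    ... | tri> _ _ q<p = inj₂ (1≤q , q<p , p≤n , S-sym x x∈S)

module CadetConditions (S : List ℤ) (S-sym : ∀ s → s ∈ S → - s ∈ S) (m : ℕ) (S≤m : ∀ s → s ∈ S → s ℤ.≤ + m)
                       (n : ℕ) (T : Tree m) (μ : Marking) (marked : IsMarked m n T μ)
                       (connected : AConnected S n T μ) where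

  distinct : Unique (labels T)
  distinct = Unique-resp-↭ (↭⇒↭ₛ (↭-sym (proj₁ marked))) (Unique.map⁺ ℕ.suc-injective (Unique.upTo⁺ n))

  label-range : {p : ℕ} → Node T p → 1 ≤ p × p ≤ n
  label-range p∈ with q , q∈ , refl ← ∈-map⁻ suc (∈-resp-↭ (proj₁ marked) p∈) = s≤s z≤n , ∈-upTo⁻ q∈

  open LabelledTree T distinct
  open Blocks T distinct μ (proj₁ (proj₂ marked))

  drift-difference : {p q k : ℕ} → drift T q + k ≡ drift T p → + drift T p ℤ.- + drift T q ≡ + k
  drift-difference {q = q} {k} e =
    trans (cong (λ x → + x ℤ.- + drift T q) (sym e)) (+[m+k]-+m≡+k (drift T q) k)

  driftHyp⁺ : {p q : ℕ} → Node T p → Node T q → p ≢ q → + drift T p ℤ.- + drift T q ∈ S → DriftHyp S n T p q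
  driftHyp⁺ p∈ q∈ = HypIn⁺ S-sym (label-range p∈) (label-range q∈)

  DriftHyp-sym : {p q : ℕ} → DriftHyp S n T p q → DriftHyp S n T q p
  DriftHyp-sym {p} {q} h = subst (HypIn S n q p) (sym (+m-+n≡-[+n-+m] (drift T q) (drift T p))) (HypIn-swap h)

  offset∈S : {p q k : ℕ} → DriftHyp S n T p q → drift T q + k ≡ drift T p → + k ∈ S
  offset∈S h e = subst (_∈ S) (drift-difference e) (HypIn⇒∈ S-sym h)

  Linked : ℕ → ℕ → Set
  Linked i j = ∃[ i′ ] ∃[ j′ ] (InBlock T μ i i′ × InBlock T μ j j′ × DriftHyp S n T i′ j′)

  neighbour : {r : ℕ} → Node T r → BigBlock T μ r → ∃[ a ] (InBlock T μ r a × DriftHyp S n T r a)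
  neighbour {r} r∈ (k , k∈B , k≢r) with connected r r∈ r k (r∈ , inj₁ refl) k∈B
  ... | ε = contradiction refl k≢r
  ... | (_ , a∈B , h) ◅ _ = _ , a∈B , h

  module FreeCadetEdge {i j : ℕ} {s : Fin (suc m)} (cd : IsCadet T i j s) (free : ¬ InMu μ i j) where

    j∈ : Node T j
    j∈ = proj₁ (proj₁ cd)

    i∈ : Node T i
    i∈ = child-node (proj₁ cd)

    i-top : IsTop T μ i i
    i-top = (i∈ , inj₁ refl) , λ _ → child-block-below (proj₁ cd) free

    i≤ : ∀ {i′} → InBlock T μ i i′ → drift T i ≤ drift T i′
    i≤ i′∈B = drift-mono (child-block-below (proj₁ cd) free i′∈B)

    j-bottom : ∀ k → InBlock T μ j k → IsPrefix (addr T k) (addr T j)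
    j-bottom _ = parent-block-above cd free

    open BlockWithBottom j∈ (proj₂ (top-of-block j∈ j-bottom)) j-bottom

    EndOffset : ℕ → Set
    EndOffset d = ∃[ j′ ] (InBlock T μ j j′ × drift T j′ + d ≡ drift T j)

    StartOffset : ℕ → Set
    StartOffset d = ∃[ i′ ] (InBlock T μ i i′ × drift T i + d ≡ drift T i′)

    end⇒offset : {d : ℕ} → d ≡ 0 ⊎ InEnd T μ j d → EndOffset d
    end⇒offset (inj₁ refl) = j , r∈B , ℕ.+-identityʳ _
    end⇒offset (inj₂ d∈end) = InEnd⁻ d∈end

    offset⇒end : {d : ℕ} → d < m → EndOffset d → d ≡ 0 ⊎ InEnd T μ j d
    offset⇒end {zero} _ _ = inj₁ refl
    offset⇒end {suc d} d<m (j′ , j′∈B , e) = inj₂ (InEnd⁺ j′∈B e (s≤s z≤n) d<m)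

    start⇒offset : {d : ℕ} → d ≡ 0 ⊎ InStart T μ i d → StartOffset d
    start⇒offset (inj₁ refl) = i , (i∈ , inj₁ refl) , ℕ.+-identityʳ _
    start⇒offset (inj₂ (_ , _ , d∈shadow)) = InShadow⁻ i-top d∈shadow

    offset⇒start : {d : ℕ} → d < m → StartOffset d → d ≡ 0 ⊎ InStart T μ i d
    offset⇒start {zero} _ _ = inj₁ refl
    offset⇒start {suc d} d<m (i′ , i′∈B , e) = inj₂ (s≤s z≤n , d<m , InShadow⁺ i-top i′∈B e)

    blocks-disjoint : {i′ j′ : ℕ} → InBlock T μ i i′ → InBlock T μ j j′ → i′ ≢ j′
    blocks-disjoint i′∈B j′∈B refl = ℕ.<⇒≱ (child-deeper (proj₁ cd))
      (≤-trans (prefix-length (child-block-below (proj₁ cd) free i′∈B)) (prefix-length (j-bottom _ j′∈B)))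

    across : {i′ j′ d d′ : ℕ} → drift T j′ + d ≡ drift T j → drift T i + d′ ≡ drift T i′ →
      drift T j′ + (toℕ s + d + d′) ≡ drift T i′
    across {j′ = j′} {d} {d′} e e′ =
      chain-offsets {drift T j′} d (toℕ s) d′ e (sym (drift-child (proj₁ cd))) e′

    Offsets : Set
    Offsets = ∃[ d ] ∃[ d′ ] (EndOffset d × StartOffset d′ × + (toℕ s + d + d′) ∈ S)

    linked⇔offsets : Linked i j ⇔ Offsets
    linked⇔offsets = mk⇔ to from
      where
      to : Linked i j → Offsets
      to (i′ , j′ , i′∈B , j′∈B , h) =
        _ , _ , (j′ , j′∈B , m+[n∸m]≡n (≤r j′∈B)) , (i′ , i′∈B , m+[n∸m]≡n (i≤ i′∈B)) ,
        offset∈S h (across (m+[n∸m]≡n (≤r j′∈B)) (m+[n∸m]≡n (i≤ i′∈B)))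

      from : Offsets → Linked i j
      from (d , d′ , (j′ , j′∈B , e) , (i′ , i′∈B , e′) , sdd′∈S) =
        i′ , j′ , i′∈B , j′∈B , driftHyp⁺ (proj₁ i′∈B) (proj₁ j′∈B) (blocks-disjoint i′∈B j′∈B)
                                          (subst (_∈ S) (sym (drift-difference (across e e′))) sdd′∈S)

    InC-at : Set
    InC-at = InC S m (InEnd T μ j) (InStart T μ i) (toℕ s)

    offsets⇔InC : 0 < toℕ s → Offsets ⇔ InC-at
    offsets⇔InC 0<s = mk⇔ to from
      where
      to : Offsets → InC-at
      to (d , d′ , o , o′ , sdd′∈S) =
        inj₂ (0<s , Fin.toℕ≤pred[n] s , d , d′ , offset⇒end d<m o , offset⇒start d′<m o′ , sdd′∈S)
        where
        sdd′≤m : toℕ s + d + d′ ≤ m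
        sdd′≤m = ℤ.drop‿+≤+ (S≤m _ sdd′∈S)
        d<m : d < m
        d<m = <-≤-trans (ℕ.m<n+m d 0<s) (≤-trans (m≤m+n (toℕ s + d) d′) sdd′≤m)
        d′<m : d′ < m
        d′<m = <-≤-trans (ℕ.m<n+m d′ (<-≤-trans 0<s (m≤m+n (toℕ s) d))) sdd′≤m

      from : InC-at → Offsets
      from (inj₁ s≡0) = contradiction (sym s≡0) (ℕ.<⇒≢ 0<s)
      from (inj₂ (_ , _ , d , d′ , d∈ , d′∈ , sdd′∈S)) = d , d′ , end⇒offset d∈ , start⇒offset d′∈ , sdd′∈S

    linked⇔InC : 0 < toℕ s → Linked i j ⇔ InC-at
    linked⇔InC 0<s = offsets⇔InC 0<s ⇔-∘ linked⇔offsets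

    linked-if-0∈S : toℕ s ≡ 0 → + 0 ∈ S → Linked i j
    linked-if-0∈S s≡0 0∈S = Equivalence.from linked⇔offsets
      (0 , 0 , end⇒offset (inj₁ refl) , start⇒offset (inj₁ refl) ,
       subst (λ x → + (x + 0 + 0) ∈ S) (sym s≡0) 0∈S)

    big⇒linked : toℕ s ≡ 0 → BigBlock T μ j ⊎ BigBlock T μ i → Linked i j
    big⇒linked s≡0 (inj₁ big) with a , a∈B , h ← neighbour j∈ big =
      Equivalence.from linked⇔offsets
        (d , 0 , (a , a∈B , e) , start⇒offset (inj₁ refl) , subst (_∈ S) (cong +_ d≡s+d+0) (offset∈S h e))
      where
      d : ℕ
      d = drift T j ∸ drift T a
      e : drift T a + d ≡ drift T j
      e = m+[n∸m]≡n (≤r a∈B)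
      d≡s+d+0 : d ≡ toℕ s + d + 0
      d≡s+d+0 = trans (sym (ℕ.+-identityʳ d)) (cong (λ x → x + d + 0) (sym s≡0))
    big⇒linked s≡0 (inj₂ big) with a , a∈B , h ← neighbour i∈ big =
      Equivalence.from linked⇔offsets
        (0 , _ , end⇒offset (inj₁ refl) , (a , a∈B , e) ,
         subst (λ x → + (x + 0 + _) ∈ S) (sym s≡0) (offset∈S (DriftHyp-sym h) e))
      where
      e : drift T i + (drift T a ∸ drift T i) ≡ drift T a
      e = m+[n∸m]≡n (i≤ a∈B)

    linked⇒big : toℕ s ≡ 0 → + 0 ∉ S → Linked i j → BigBlock T μ j ⊎ BigBlock T μ i
    linked⇒big s≡0 0∉S (i′ , j′ , i′∈B , j′∈B , h) with i′ ℕ.≟ i | j′ ℕ.≟ j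
    ... | no i′≢i | _ = inj₂ (i′ , i′∈B , i′≢i)
    ... | yes _ | no j′≢j = inj₁ (j′ , j′∈B , j′≢j)
    ... | yes refl | yes refl =
      contradiction (offset∈S h (trans (cong (λ x → drift T j + x) (sym s≡0)) (sym (drift-child (proj₁ cd)))))
                    0∉S

    CadetAt : Set
    CadetAt = (toℕ s ≡ 0 × i < j) ⊎ Linked i j

    cadet⇔cond₁ : + 0 ∈ S → CadetAt ⇔ InC-at
    cadet⇔cond₁ 0∈S = mk⇔ to from
      where
      to : CadetAt → InC-at
      to (inj₁ (s≡0 , _)) = inj₁ s≡0
      to (inj₂ linked) with zero⊎positive (toℕ s)
      ... | inj₁ s≡0 = inj₁ s≡0
      ... | inj₂ 0<s = Equivalence.to (linked⇔InC 0<s) linked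

      from : InC-at → CadetAt
      from c with zero⊎positive (toℕ s)
      ... | inj₁ s≡0 = inj₂ (linked-if-0∈S s≡0 0∈S)
      ... | inj₂ 0<s = inj₂ (Equivalence.from (linked⇔InC 0<s) c)

    Cond₂-at : Set
    Cond₂-at = InC-at × (0 < toℕ s ⊎ BigBlock T μ j ⊎ BigBlock T μ i ⊎ i < j)

    cadet⇔cond₂ : + 0 ∉ S → CadetAt ⇔ Cond₂-at
    cadet⇔cond₂ 0∉S = mk⇔ to from
      where
      to : CadetAt → Cond₂-at
      to (inj₁ (s≡0 , i<j)) = inj₁ s≡0 , inj₂ (inj₂ (inj₂ i<j))
      to (inj₂ linked) with zero⊎positive (toℕ s)
      ... | inj₁ s≡0 = inj₁ s≡0 , inj₂ (Sum.map₂ inj₁ (linked⇒big s≡0 0∉S linked))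
      ... | inj₂ 0<s = Equivalence.to (linked⇔InC 0<s) linked , inj₁ 0<s

      from : Cond₂-at → CadetAt
      from (c , extra) with zero⊎positive (toℕ s) | extra
      ... | inj₂ 0<s | _ = inj₂ (Equivalence.from (linked⇔InC 0<s) c)
      ... | inj₁ s≡0 | inj₁ 0<s = contradiction (sym s≡0) (ℕ.<⇒≢ 0<s)
      ... | inj₁ s≡0 | inj₂ (inj₁ big) = inj₂ (big⇒linked s≡0 (inj₁ big))
      ... | inj₁ s≡0 | inj₂ (inj₂ (inj₁ big)) = inj₂ (big⇒linked s≡0 (inj₂ big))
      ... | inj₁ s≡0 | inj₂ (inj₂ (inj₂ i<j)) = inj₁ (s≡0 , i<j)

  InTbarA⇔ : {P : ℕ → ℕ → Fin (suc m) → Set} →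
    (∀ {i j s} (cd : IsCadet T i j s) (free : ¬ InMu μ i j) → FreeCadetEdge.CadetAt cd free ⇔ P i j s) →
    InTbarA S m n T μ ⇔ (∀ i j s → IsCadet T i j s → ¬ InMu μ i j → P i j s)
  InTbarA⇔ pointwise = mk⇔
    (λ (_ , _ , cadet) i j s cd free → Equivalence.to (pointwise cd free) (cadet i j s cd free))
    (λ cond → marked , connected ,
              λ i j s cd free → Equivalence.from (pointwise cd free) (cond i j s cd free))

lemma5p9 : (S : List ℤ)
    → (∀ s → s ∈ S → - s ∈ S)
    → (∀ (s t : ℕ) → + s ∉ S → + t ∉ S → + (s + t) ∉ S)
    → (m : ℕ) → + m ∈ S → (∀ s → s ∈ S → s ℤ.≤ + m)
    → (n : ℕ) → 1 ≤ n
    → (T : Tree m) (μ : Marking)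
    → IsMarked m n T μ
    → AConnected S n T μ
    → (+ 0 ∈ S → (InTbarA S m n T μ ⇔ Cond1 S T μ))
    × (+ 0 ∉ S → (InTbarA S m n T μ ⇔ Cond2 S T μ))
lemma5p9 S S-sym _ m _ S≤m n _ T μ marked connected =
    (λ 0∈S → InTbarA⇔ λ cd free → FreeCadetEdge.cadet⇔cond₁ cd free 0∈S)
  , (λ 0∉S → InTbarA⇔ λ cd free → FreeCadetEdge.cadet⇔cond₂ cd free 0∉S)
  where open CadetConditions S S-sym m S≤m n T μ marked connected
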